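{- Let $n\geq1$ and let $x=x_1x_2\cdots x_n$ be a revised ascent sequence. Then (1) $x_1=\max(x)$; (2) if $n\geq 2$, then $\max(x)$ occurs at least twice in $x$; (3) $\max(x)=\mathrm{ascbot}(x)=\mathrm{asctop}(x)$.
   Context: An endofunction of size $n$ is a word $x=x_1\cdots x_n$ with entries in $\{1,\dots,n\}$; it is a Cayley permutation if it contains every integer between $1$ and $\max(x)$. Let $\mathrm{Ascbot}(x)=\{1\}\cup\{i:1\leq i\leq n-1,\ x_i<x_{i+1}\}$, $\mathrm{Asctop}(x)=\{1\}\cup\{i:2\leq i\leq n,\ x_{i-1}<x_i\}$, and $\mathrm{ascbot}(x)$, $\mathrm{asctop}(x)$ their cardinalities. Let $\mathrm{Nub}(x)$ be the set of indices $i$ such that $x_i$ is the leftmost occurrence of its value. A revised ascent sequence of length $n$ is a Cayley permutation $x$ of length $n$ with $\mathrm{Ascbot}(x)=\mathrm{Nub}(x)$. -}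

module Defs where

open import Data.Nat using (ℕ; zero; suc; _≤_; _<_; _≟_; _<?_; _≤?_; _⊔_)
open import Data.Fin using (Fin; toℕ)
open import Data.Fin.Properties using (any?; all?)
open import Data.Fin.Subset using (Subset)
open import Data.Vec using (Vec; lookup; tabulate; foldr)
open import Data.Product using (Σ; _×_; _,_; ∃)
open import Data.Sum using (_⊎_)
open import Relation.Binary.PropositionalEquality using (_≡_; _≢_)
open import Relation.Nullary using (Dec; ¬_; does)
open import Relation.Nullary.Decidable using (_⊎-dec_; _×-dec_; _→-dec_; ¬?)

-- Positions are Fin n (0-based): Fin index i stands for the paper's
-- position (toℕ i + 1). Entry x_{i+1} of the paper is  lookup x i.

maxW : ∀ {n} → Vec ℕ n → ℕ
maxW = foldr _ _⊔_ 0

IsEndofunction : ∀ {n} → Vec ℕ n → Set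
IsEndofunction {n} x = ∀ (i : Fin n) → 1 ≤ lookup x i × lookup x i ≤ n

IsCayley : ∀ {n} → Vec ℕ n → Set
IsCayley {n} x = IsEndofunction x ×
  (∀ k → 1 ≤ k → k ≤ maxW x → ∃ λ (i : Fin n) → lookup x i ≡ k)

AscbotP : ∀ {n} → Vec ℕ n → Fin n → Set
AscbotP {n} x i = toℕ i ≡ 0 ⊎
  (∃ λ (j : Fin n) → toℕ j ≡ suc (toℕ i) × lookup x i < lookup x j)

AsctopP : ∀ {n} → Vec ℕ n → Fin n → Set
AsctopP {n} x i = toℕ i ≡ 0 ⊎
  (∃ λ (j : Fin n) → suc (toℕ j) ≡ toℕ i × lookup x j < lookup x i)

NubP : ∀ {n} → Vec ℕ n → Fin n → Set
NubP {n} x i = ∀ (j : Fin n) → toℕ j < toℕ i → lookup x j ≢ lookup x i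

ascbotP? : ∀ {n} (x : Vec ℕ n) i → Dec (AscbotP x i)
ascbotP? x i = (toℕ i ≟ 0) ⊎-dec any? (λ j → (toℕ j ≟ suc (toℕ i)) ×-dec (lookup x i <? lookup x j))

asctopP? : ∀ {n} (x : Vec ℕ n) i → Dec (AsctopP x i)
asctopP? x i = (toℕ i ≟ 0) ⊎-dec any? (λ j → (suc (toℕ j) ≟ toℕ i) ×-dec (lookup x j <? lookup x i))

nubP? : ∀ {n} (x : Vec ℕ n) i → Dec (NubP x i)
nubP? x i = all? (λ j → (toℕ j <? toℕ i) →-dec ¬? (lookup x j ≟ lookup x i))

Ascbot : ∀ {n} → Vec ℕ n → Subset n
Ascbot x = tabulate (λ i → does (ascbotP? x i))

Asctop : ∀ {n} → Vec ℕ n → Subset n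
Asctop x = tabulate (λ i → does (asctopP? x i))

Nub : ∀ {n} → Vec ℕ n → Subset n
Nub x = tabulate (λ i → does (nubP? x i))

IsRevisedAscent : ∀ {n} → Vec ℕ n → Set
IsRevisedAscent x = IsCayley x × Ascbot x ≡ Nub x

{-# OPTIONS --safe #-}
-- The leftmost occurrence of any value lies in Nub, hence in Ascbot, so it is either the first
-- position or is followed by a strictly larger entry.  If w is attained and no entry after the
-- first exceeds w, the leftmost occurrence of w is therefore x₁; taking w = max(x) gives (1), and
-- taking w = max(x₂⋯xₙ) gives x₁ = w, an occurrence of max(x) besides x₁, hence (2).
-- For (3), counting the pairs (i, v) with i the leftmost occurrence of v in two ways gives
-- |Nub| = max for a Cayley permutation; and since x₁ = max(x) is not an ascent bottom, both
-- Ascbot and Asctop consist of position 1 together with one position per ascent.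
module Submission where

open import Defs
open import Data.Nat using (ℕ; suc; _≤_)
open import Data.Fin using (Fin; zero)
open import Data.Fin.Subset using (∣_∣)
open import Data.Vec using (Vec; lookup)
open import Data.Product using (_×_; ∃₂)
open import Relation.Binary.PropositionalEquality using (_≡_; _≢_)

open import Data.Bool using (Bool; true; false)
open import Data.Fin using (toℕ; fromℕ; fromℕ<; inject; inject₁; punchIn) renaming (suc to fsuc)
open import Data.Fin.Properties
  using ( toℕ-injective; toℕ-fromℕ; toℕ-fromℕ<; toℕ-inject; toℕ-inject₁; toℕ<n
        ; punchInᵢ≢i; <-cmp; ¬∀⟶∃¬-smallest)
open import Data.Nat using (_<_; _+_; _⊔_; _≟_; _<?_; z≤n; s≤s)
open import Data.Nat.Properties
  using ( +-0-commutativeMonoid; +-identityʳ; suc-injective; <-irrefl; <⇒≱; ≤⇒≯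
        ; ⊔-sel; ⊔-idem; ⊔-identityʳ; m≤m⊔n; m≤n⇒m≤o⊔n)
open import Algebra.Properties.CommutativeMonoid.Sum +-0-commutativeMonoid
  using (sum; sum-syntax; sum-remove; sum-cong-≗; sum-replicate-zero; sum-init-last; ∑-comm)
open import Data.Product using (∃; _,_; proj₁; proj₂)
open import Data.Sum using (inj₁; inj₂; [_,_]′)
open import Data.Vec using ([]; _∷_; tabulate)
open import Data.Vec.Functional using (Vector)
open import Data.Vec.Properties using (lookup∘tabulate)
open import Function using (_∘_; _⇔_; mk⇔; Equivalence)
open import Relation.Binary using (tri<; tri≈; tri>)
open import Relation.Binary.PropositionalEquality using (refl; sym; trans; cong; subst; module ≡-Reasoning)
open import Relation.Nullary using (Dec; yes; no; does; ¬_; contradiction)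
open import Relation.Nullary.Decidable using (¬?; _×-dec_; toSum; dec-true; dec-false; does-⇔; decidable-stable)

indicator : Bool → ℕ
indicator true = 1
indicator false = 0

module _ {p} {P : Set p} (P? : Dec P) where

  indicator-yes : P → indicator (does P?) ≡ 1
  indicator-yes = cong indicator ∘ dec-true P?

  indicator-no : ¬ P → indicator (does P?) ≡ 0
  indicator-no = cong indicator ∘ dec-false P?

∣tabulate∣≡∑ : ∀ {n} (h : Fin n → Bool) → ∣ tabulate h ∣ ≡ sum (indicator ∘ h)
∣tabulate∣≡∑ {ℕ.zero} h = refl
∣tabulate∣≡∑ {suc n} h with h zero
... | true  = cong suc (∣tabulate∣≡∑ (h ∘ fsuc))
... | false = ∣tabulate∣≡∑ (h ∘ fsuc)

sum-ones : ∀ n → sum {n} (λ _ → 1) ≡ n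
sum-ones ℕ.zero = refl
sum-ones (suc n) = cong suc (sum-ones n)

sum-vanishing : ∀ {n} (t : Vector ℕ n) → (∀ j → t j ≡ 0) → sum t ≡ 0
sum-vanishing {n} t t≡0 = trans (sum-cong-≗ t≡0) (sum-replicate-zero n)

sum-supported-at : ∀ {n} (t : Vector ℕ n) (i : Fin n) → (∀ j → j ≢ i → t j ≡ 0) → sum t ≡ t i
sum-supported-at {suc n} t i t≡0 = begin
  sum t                        ≡⟨ sum-remove t ⟩
  t i + sum (t ∘ punchIn i)    ≡⟨ cong (t i +_) (sum-vanishing _ (λ j → t≡0 (punchIn i j) (punchInᵢ≢i i j))) ⟩
  t i + 0                      ≡⟨ +-identityʳ (t i) ⟩
  t i                          ∎
  where open ≡-Reasoning

does-≡⇒⇔ : ∀ {a b} {A : Set a} {B : Set b} (A? : Dec A) (B? : Dec B) → does A? ≡ does B? → A ⇔ B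
does-≡⇒⇔ (yes a) (yes b) _ = mk⇔ (λ _ → b) (λ _ → a)
does-≡⇒⇔ (no ¬a) (no ¬b) _ = mk⇔ (λ a → contradiction a ¬a) (λ b → contradiction b ¬b)

module _ {n p q} {P : Fin n → Set p} {Q : Fin n → Set q} where

  tabulate-does-≡⇒⇔ : (P? : ∀ i → Dec (P i)) (Q? : ∀ i → Dec (Q i)) →
    tabulate (does ∘ P?) ≡ tabulate (does ∘ Q?) → ∀ i → P i ⇔ Q i
  tabulate-does-≡⇒⇔ P? Q? eq i = does-≡⇒⇔ (P? i) (Q? i) (begin
    does (P? i)                     ≡⟨ lookup∘tabulate (does ∘ P?) i ⟨
    lookup (tabulate (does ∘ P?)) i ≡⟨ cong (λ s → lookup s i) eq ⟩
    lookup (tabulate (does ∘ Q?)) i ≡⟨ lookup∘tabulate (does ∘ Q?) i ⟩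
    does (Q? i)                     ∎)
    where open ≡-Reasoning

module _ {n} (x : Vec ℕ n) where

  leftmost-occurrence : ∀ {w} i → lookup x i ≡ w → ∃ λ j → lookup x j ≡ w × NubP x j
  leftmost-occurrence {w} i xᵢ≡w
    with ¬∀⟶∃¬-smallest n (λ j → lookup x j ≢ w) (λ j → ¬? (lookup x j ≟ w)) (λ ≢w → ≢w i xᵢ≡w)
  ... | j , ¬xⱼ≢w , before-j = j , xⱼ≡w , nub
    where
    xⱼ≡w : lookup x j ≡ w
    xⱼ≡w = decidable-stable (lookup x j ≟ w) ¬xⱼ≢w
    nub : NubP x j
    nub k k<j xₖ≡xⱼ = before-j (fromℕ< k<j) (subst (λ l → lookup x l ≡ w) (sym inject≡k) (trans xₖ≡xⱼ xⱼ≡w))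
      where
      inject≡k : inject (fromℕ< k<j) ≡ k
      inject≡k = toℕ-injective (trans (toℕ-inject (fromℕ< k<j)) (toℕ-fromℕ< k<j))

  leftmost-occurrence-unique : ∀ {i j} → lookup x i ≡ lookup x j → NubP x i → NubP x j → i ≡ j
  leftmost-occurrence-unique {i} {j} xᵢ≡xⱼ nubᵢ nubⱼ with <-cmp i j
  ... | tri< i<j _ _ = contradiction xᵢ≡xⱼ (nubⱼ i i<j)
  ... | tri≈ _ i≡j _ = i≡j
  ... | tri> _ _ j<i = contradiction (sym xᵢ≡xⱼ) (nubᵢ j j<i)

  ∣Nub∣≡#values : ∀ B → (∀ i → ∃ λ (v : Fin B) → lookup x i ≡ suc (toℕ v)) →
    (∀ (v : Fin B) → ∃ λ i → lookup x i ≡ suc (toℕ v)) → ∣ Nub x ∣ ≡ B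
  ∣Nub∣≡#values B value-of occurrence-of = begin
    ∣ Nub x ∣                                ≡⟨ ∣tabulate∣≡∑ (does ∘ nubP? x) ⟩
    ∑[ i < n ] indicator (does (nubP? x i))  ≡⟨ sum-cong-≗ nub≡∑values ⟩
    ∑[ i < n ] ∑[ v < B ] firstOcc i v       ≡⟨ ∑-comm firstOcc ⟩
    ∑[ v < B ] ∑[ i < n ] firstOcc i v       ≡⟨ sum-cong-≗ ∑firstOcc≡1 ⟩
    ∑[ v < B ] 1                             ≡⟨ sum-ones B ⟩
    B                                        ∎
    where
    open ≡-Reasoning
    firstOcc? : ∀ i (v : Fin B) → Dec (lookup x i ≡ suc (toℕ v) × NubP x i)
    firstOcc? i v = (lookup x i ≟ suc (toℕ v)) ×-dec nubP? x i

    firstOcc : Fin n → Fin B → ℕ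
    firstOcc i v = indicator (does (firstOcc? i v))

    nub≡∑values : ∀ i → indicator (does (nubP? x i)) ≡ ∑[ v < B ] firstOcc i v
    nub≡∑values i = [ nub⇒ , ¬nub⇒ ]′ (toSum (nubP? x i))
      where
      vᵢ = proj₁ (value-of i)
      xᵢ≡vᵢ = proj₂ (value-of i)
      value≡ : ∀ {v} → lookup x i ≡ suc (toℕ v) → v ≡ vᵢ
      value≡ xᵢ≡v = toℕ-injective (suc-injective (trans (sym xᵢ≡v) xᵢ≡vᵢ))

      nub⇒ : NubP x i → indicator (does (nubP? x i)) ≡ ∑[ v < B ] firstOcc i v
      nub⇒ nub = begin
        indicator (does (nubP? x i))  ≡⟨ indicator-yes (nubP? x i) nub ⟩
        1                             ≡⟨ indicator-yes (firstOcc? i vᵢ) (xᵢ≡vᵢ , nub) ⟨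
        firstOcc i vᵢ                 ≡⟨ sum-supported-at _ vᵢ (λ v v≢vᵢ →
                                           indicator-no (firstOcc? i v) (v≢vᵢ ∘ value≡ ∘ proj₁)) ⟨
        ∑[ v < B ] firstOcc i v       ∎

      ¬nub⇒ : ¬ NubP x i → indicator (does (nubP? x i)) ≡ ∑[ v < B ] firstOcc i v
      ¬nub⇒ ¬nub = trans (indicator-no (nubP? x i) ¬nub)
        (sym (sum-vanishing _ (λ v → indicator-no (firstOcc? i v) (¬nub ∘ proj₂))))

    ∑firstOcc≡1 : ∀ v → ∑[ i < n ] firstOcc i v ≡ 1
    ∑firstOcc≡1 v with occurrence-of v
    ... | i , xᵢ≡v with leftmost-occurrence i xᵢ≡v
    ...   | j , xⱼ≡v , nubⱼ = begin
      ∑[ i < n ] firstOcc i v  ≡⟨ sum-supported-at _ j (λ k k≢j → indicator-no (firstOcc? k v) (λ (xₖ≡v , nubₖ) →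
                                    k≢j (leftmost-occurrence-unique (trans xₖ≡v (sym xⱼ≡v)) nubₖ nubⱼ))) ⟩
      firstOcc j v             ≡⟨ indicator-yes (firstOcc? j v) (xⱼ≡v , nubⱼ) ⟩
      1                        ∎

lookup≤maxW : ∀ {n} (x : Vec ℕ n) i → lookup x i ≤ maxW x
lookup≤maxW (a ∷ x) zero     = m≤m⊔n a (maxW x)
lookup≤maxW (a ∷ x) (fsuc i) = m≤n⇒m≤o⊔n a (lookup≤maxW x i)

maxW-attained : ∀ {m} (x : Vec ℕ (suc m)) → ∃ λ i → lookup x i ≡ maxW x
maxW-attained (a ∷ []) = zero , sym (⊔-identityʳ a)
maxW-attained (a ∷ y@(_ ∷ _)) with ⊔-sel a (maxW y)
... | inj₁ a⊔y≡a = zero , sym a⊔y≡a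
... | inj₂ a⊔y≡y = let i , yᵢ≡max = maxW-attained y in fsuc i , trans yᵢ≡max (sym a⊔y≡y)

module _ {m} (x : Vec ℕ (suc m)) (nub⇒ascbot : ∀ i → NubP x i → AscbotP x i) where

  attained-tail-bound≡head : ∀ {w} i → lookup x i ≡ w → (∀ j → lookup x (fsuc j) ≤ w) → lookup x zero ≡ w
  attained-tail-bound≡head i xᵢ≡w tail≤w with leftmost-occurrence x i xᵢ≡w
  ... | zero , x₀≡w , _ = x₀≡w
  ... | fsuc j , xⱼ₊₁≡w , nub with nub⇒ascbot (fsuc j) nub
  ...   | inj₂ (fsuc k , _ , xⱼ₊₁<xₖ₊₁) =
    contradiction (tail≤w k) (<⇒≱ (subst (_< lookup x (fsuc k)) xⱼ₊₁≡w xⱼ₊₁<xₖ₊₁))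

  head≡maxW : lookup x zero ≡ maxW x
  head≡maxW = let i , xᵢ≡max = maxW-attained x in
    attained-tail-bound≡head i xᵢ≡max (λ j → lookup≤maxW x (fsuc j))

maxW-occurs-twice : ∀ {m} (x : Vec ℕ (suc m)) → 2 ≤ suc m → (∀ i → NubP x i → AscbotP x i) →
  ∃₂ λ i j → i ≢ j × lookup x i ≡ maxW x × lookup x j ≡ maxW x
maxW-occurs-twice (a ∷ []) (s≤s ())
maxW-occurs-twice (a ∷ y@(_ ∷ _)) _ nub⇒ascbot =
  zero , fsuc i , (λ ()) , head≡maxW (a ∷ y) nub⇒ascbot , trans yᵢ≡maxy (sym max≡maxy)
  where
  i = proj₁ (maxW-attained y)
  yᵢ≡maxy = proj₂ (maxW-attained y)
  a≡maxy : a ≡ maxW y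
  a≡maxy = attained-tail-bound≡head (a ∷ y) nub⇒ascbot (fsuc i) yᵢ≡maxy (lookup≤maxW y)
  max≡maxy : maxW (a ∷ y) ≡ maxW y
  max≡maxy = trans (cong (_⊔ maxW y) a≡maxy) (⊔-idem (maxW y))

module _ {m} (x : Vec ℕ (suc m)) where

  Ascent : Fin m → Set
  Ascent i = lookup x (inject₁ i) < lookup x (fsuc i)

  ascent? : ∀ i → Dec (Ascent i)
  ascent? i = lookup x (inject₁ i) <? lookup x (fsuc i)

  AsctopP-suc⇔Ascent : ∀ i → AsctopP x (fsuc i) ⇔ Ascent i
  AsctopP-suc⇔Ascent i = mk⇔ to (λ ascent → inj₂ (inject₁ i , cong suc (toℕ-inject₁ i) , ascent))
    where
    to : AsctopP x (fsuc i) → Ascent i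
    to (inj₂ (j , 1+j≡1+i , xⱼ<xᵢ₊₁)) = subst (λ k → lookup x k < lookup x (fsuc i)) j≡i xⱼ<xᵢ₊₁
      where j≡i = toℕ-injective (trans (suc-injective 1+j≡1+i) (sym (toℕ-inject₁ i)))

module _ {k} (x : Vec ℕ (suc (suc k))) where

  AscbotP-suc⇔Ascent-suc : ∀ (i : Fin k) → AscbotP x (fsuc (inject₁ i)) ⇔ Ascent x (fsuc i)
  AscbotP-suc⇔Ascent-suc i = mk⇔ to (λ ascent → inj₂ (fsuc (fsuc i) , cong (suc ∘ suc) (sym (toℕ-inject₁ i)) , ascent))
    where
    to : AscbotP x (fsuc (inject₁ i)) → Ascent x (fsuc i)
    to (inj₂ (j , j≡i+2 , xᵢ₊₁<xⱼ)) = subst (λ l → lookup x (fsuc (inject₁ i)) < lookup x l) j≡i+2′ xᵢ₊₁<xⱼ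
      where j≡i+2′ = toℕ-injective (trans j≡i+2 (cong (suc ∘ suc) (toℕ-inject₁ i)))

  last∉Ascbot : ¬ AscbotP x (fsuc (fromℕ k))
  last∉Ascbot (inj₂ (j , j≡k+2 , _)) = <-irrefl (trans j≡k+2 (cong (suc ∘ suc) (toℕ-fromℕ k))) (toℕ<n j)

∣Asctop∣≡∣Ascbot∣ : ∀ {m} (x : Vec ℕ (suc m)) → (∀ j → lookup x j ≤ lookup x zero) →
  ∣ Asctop x ∣ ≡ ∣ Ascbot x ∣
∣Asctop∣≡∣Ascbot∣ {ℕ.zero} x _ = refl
∣Asctop∣≡∣Ascbot∣ {suc k} x head-max = begin
  ∣ Asctop x ∣                                 ≡⟨ ∣tabulate∣≡∑ (does ∘ asctopP? x) ⟩
  suc (∑[ i < suc k ] top (fsuc i))            ≡⟨ cong suc (sum-cong-≗ (cong indicator ∘ top≡ascent)) ⟩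
  suc (ascent zero + ∑[ i < k ] ascent (fsuc i)) ≡⟨ cong (λ a → suc (a + ∑[ i < k ] ascent (fsuc i))) no-ascent₀ ⟩
  suc (∑[ i < k ] ascent (fsuc i))             ≡⟨ cong suc (sum-cong-≗ (cong indicator ∘ bot≡ascent)) ⟨
  suc (∑[ i < k ] bot (fsuc (inject₁ i)))      ≡⟨ cong suc (+-identityʳ _) ⟨
  suc (∑[ i < k ] bot (fsuc (inject₁ i)) + 0)  ≡⟨ cong (λ b → suc (∑[ i < k ] bot (fsuc (inject₁ i)) + b)) no-bot-last ⟨
  suc (∑[ i < k ] bot (fsuc (inject₁ i)) + bot (fsuc (fromℕ k))) ≡⟨ cong suc (sum-init-last (bot ∘ fsuc)) ⟨
  suc (∑[ i < suc k ] bot (fsuc i))            ≡⟨ ∣tabulate∣≡∑ (does ∘ ascbotP? x) ⟨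
  ∣ Ascbot x ∣                                 ∎
  where
  open ≡-Reasoning
  top bot : Fin (suc (suc k)) → ℕ
  top i = indicator (does (asctopP? x i))
  bot i = indicator (does (ascbotP? x i))

  ascent : Fin (suc k) → ℕ
  ascent i = indicator (does (ascent? x i))

  top≡ascent : ∀ i → does (asctopP? x (fsuc i)) ≡ does (ascent? x i)
  top≡ascent i = does-⇔ (AsctopP-suc⇔Ascent x i) (asctopP? x (fsuc i)) (ascent? x i)

  bot≡ascent : ∀ i → does (ascbotP? x (fsuc (inject₁ i))) ≡ does (ascent? x (fsuc i))
  bot≡ascent i = does-⇔ (AscbotP-suc⇔Ascent-suc x i) (ascbotP? x (fsuc (inject₁ i))) (ascent? x (fsuc i))

  no-ascent₀ : ascent zero ≡ 0
  no-ascent₀ = indicator-no (ascent? x zero) (≤⇒≯ (head-max (fsuc zero)))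

  no-bot-last : bot (fsuc (fromℕ k)) ≡ 0
  no-bot-last = indicator-no (ascbotP? x (fsuc (fromℕ k))) (last∉Ascbot x)

positive≤⇒suc-toℕ : ∀ {k B} → 1 ≤ k → k ≤ B → ∃ λ (v : Fin B) → k ≡ suc (toℕ v)
positive≤⇒suc-toℕ {suc k} _ k<B = fromℕ< k<B , cong suc (sym (toℕ-fromℕ< k<B))

∣Nub∣≡maxW : ∀ {n} (x : Vec ℕ n) → IsCayley x → ∣ Nub x ∣ ≡ maxW x
∣Nub∣≡maxW x (endo , onto) = ∣Nub∣≡#values x (maxW x) value-of occurrence-of
  where
  value-of : ∀ i → ∃ λ v → lookup x i ≡ suc (toℕ v)
  value-of i = positive≤⇒suc-toℕ (proj₁ (endo i)) (lookup≤maxW x i)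
  occurrence-of : ∀ v → ∃ λ i → lookup x i ≡ suc (toℕ v)
  occurrence-of v = onto (suc (toℕ v)) (s≤s z≤n) (toℕ<n v)

mainTheorem17 : ∀ (m : ℕ) (x : Vec ℕ (suc m)) → IsRevisedAscent x →
    (lookup x zero ≡ maxW x)
    × (2 ≤ suc m → ∃₂ λ (i j : Fin (suc m)) → i ≢ j × lookup x i ≡ maxW x × lookup x j ≡ maxW x)
    × (maxW x ≡ ∣ Ascbot x ∣ × maxW x ≡ ∣ Asctop x ∣)
mainTheorem17 m x (cayley , ascbot≡nub) =
  head≡max , (λ 2≤n → maxW-occurs-twice x 2≤n nub⇒ascbot) , sym ∣Ascbot∣≡max , sym ∣Asctop∣≡max
  where
  nub⇒ascbot : ∀ i → NubP x i → AscbotP x i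
  nub⇒ascbot i = Equivalence.from (tabulate-does-≡⇒⇔ (ascbotP? x) (nubP? x) ascbot≡nub i)

  head≡max : lookup x zero ≡ maxW x
  head≡max = head≡maxW x nub⇒ascbot

  ∣Ascbot∣≡max : ∣ Ascbot x ∣ ≡ maxW x
  ∣Ascbot∣≡max = trans (cong ∣_∣ ascbot≡nub) (∣Nub∣≡maxW x cayley)

  ∣Asctop∣≡max : ∣ Asctop x ∣ ≡ maxW x
  ∣Asctop∣≡max = trans (∣Asctop∣≡∣Ascbot∣ x head-is-max) ∣Ascbot∣≡max
    where
    head-is-max : ∀ j → lookup x j ≤ lookup x zero
    head-is-max j = subst (lookup x j ≤_) (sym head≡max) (lookup≤maxW x j)
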